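{- Let $G$ be a multigraph on $[n]$ which is the union of the Hamilton cycle $H$ with cyclic order $(1\,2\,\cdots\,n)$ and a perfect matching $M$ on $[n]$; for $i\in[n]$ let $p(i)$ be the partner of $i$ in $M$. Let $1\le i_0\le i_1\le n-1$, let $c_0$ be a proper $3$-colouring (colours $\{1,2,3\}$) of the subgraph $G[[i_0]]$ induced by $[i_0]$, and let $S_0\subseteq[i_0]$ be a Sudoku set for $c_0$ on $G[[i_0]]$. Run the procedure \textbf{Sudoku} (described below) from $i_0$ to $i_1$, producing a colouring $c$ of $[i_1]$ extending $c_0$, sets $S(i)$ and pointers $\mathbf{ptr}(i)$ for $i_0\le i\le i_1$. Then $S(i_1)$ is a Sudoku set for the restriction of $c$ to the subgraph of $G$ induced by $[\mathbf{ptr}(i_1)]$.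
   Context: For a multigraph $F$ and a proper $3$-colouring $c$ of $F$, a set $S\subseteq V(F)$ is a Sudoku set for $c$ on $F$ if $c$ is the unique proper $3$-colouring of $F$ that agrees with $c$ on $S$. Procedure \textbf{Sudoku}: set $c=c_0$ on $[i_0]$, $S(i_0)=S_0$, $\mathbf{ptr}(i_0)=i_0$. For $i=i_0,i_0+1,\dots,i_1-1$, determine $c(i+1)$, $S(i+1)$, $\mathbf{ptr}(i+1)$ as follows. Case $\mathbf{ptr}(i)=i$ (run of type $A$): (A1) if $p(i+1)<i+1$ and $c(p(i+1))\neq c(i)$: let $c(i+1)$ be the unique colour not in $\{c(p(i+1)),c(i)\}$, $S(i+1)=S(i)$, $\mathbf{ptr}(i+1)=i+1$. (A2) otherwise (i.e. $p(i+1)>i+1$, or $p(i+1)<i+1$ and $c(p(i+1))=c(i)$): choose $c(i+1)$ arbitrarily (e.g. at random) from $\{1,2,3\}\setminus\{c(i)\}$, $S(i+1)=S(i)$, $\mathbf{ptr}(i+1)=i$. Case $\mathbf{ptr}(i)<i$ (run of type $B$): let $C_{i+1}=\{c(i-1),c(i)\}$ if $p(i)>i$ and $C_{i+1}=\{c(i),c(p(i))\}$ if $p(i)<i$. (B1) if $p(i+1)\le \mathbf{ptr}(i)$ and $c(p(i+1))\in C_{i+1}$: $c(i+1)$ is the unique colour not in $C_{i+1}$, $S(i+1)=S(i)$, $\mathbf{ptr}(i+1)=\mathbf{ptr}(i)$. (B2a) if $p(i+1)>i+1$: $c(i+1)$ is the unique colour not in $C_{i+1}$, $S(i+1)=S(i)\cup\{i+1\}$,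 $\mathbf{ptr}(i+1)=i+1$. (B2b) if $p(i+1)\le\mathbf{ptr}(i)$ and $c(p(i+1))\notin C_{i+1}$: $c(i+1)$ is the unique colour not in $\{c(i),c(p(i+1))\}$, $S(i+1)=S(i)\cup\{i\}$, $\mathbf{ptr}(i+1)=i+1$. (B2c) if $\mathbf{ptr}(i)+1\le p(i+1)\le i$ and $c(p(i+1))\in C_{i+1}$: $c(i+1)$ is the unique colour not in $C_{i+1}$, $S(i+1)=S(i)\cup\{i+1\}$, $\mathbf{ptr}(i+1)=i+1$. (B2d) if $\mathbf{ptr}(i)+1\le p(i+1)\le i$ and $c(p(i+1))\notin C_{i+1}$: $c(i+1)$ is the unique colour not in $\{c(i),c(p(i+1))\}$, $S(i+1)=S(i)\cup\{i,i+1\}$, $\mathbf{ptr}(i+1)=i+1$. -}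

module Defs where

open import Data.Nat using (ℕ; zero; suc; _≤_; _<_; _∸_; _<?_)
open import Data.Fin using (Fin)
open import Data.List using (List; _∷_)
open import Data.List.Membership.Propositional using (_∈_)
open import Data.Product using (_×_)
open import Data.Sum using (_⊎_)
open import Relation.Nullary using (¬_; yes; no)
open import Relation.Binary.PropositionalEquality using (_≡_; _≢_)

-- Vertices are the naturals 1,…,n ; colours are Fin 3 (standing for {1,2,3}).
Colour : Set
Colour = Fin 3

PerfectMatching : ℕ → (ℕ → ℕ) → Set
PerfectMatching n p =
  ∀ i → 1 ≤ i → i ≤ n → (1 ≤ p i) × (p i ≤ n) × (p i ≢ i) × (p (p i) ≡ i)

Adj : ℕ → (ℕ → ℕ) → ℕ → ℕ → Set
Adj n p i j =
  (j ≡ suc i) ⊎ (i ≡ suc j) ⊎ (i ≡ n × j ≡ 1) ⊎ (i ≡ 1 × j ≡ n) ⊎ (p i ≡ j)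

Proper : ℕ → (ℕ → ℕ) → ℕ → (ℕ → Colour) → Set
Proper n p k c =
  ∀ i j → 1 ≤ i → i ≤ k → 1 ≤ j → j ≤ k → Adj n p i j → c i ≢ c j

Sudoku : ℕ → (ℕ → ℕ) → ℕ → List ℕ → (ℕ → Colour) → Set
Sudoku n p k S c =
  (∀ j → j ∈ S → (1 ≤ j) × (j ≤ k)) ×
  Proper n p k c ×
  (∀ d → Proper n p k d → (∀ j → j ∈ S → d j ≡ c j) →
     ∀ j → 1 ≤ j → j ≤ k → d j ≡ c j)

-- x ∈ C_{i+1}:  C_{i+1} = {c(i-1), c(i)} if p(i) > i, and {c(i), c(p(i))} if p(i) < i.
InC : (ℕ → ℕ) → (ℕ → Colour) → ℕ → Colour → Set
InC p c i x with i <? p i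
... | yes _ = (x ≡ c (i ∸ 1)) ⊎ (x ≡ c i)
... | no _  = (x ≡ c i) ⊎ (x ≡ c (p i))

-- One step i ↦ i+1 of procedure Sudoku, relating the (final) colouring c,
-- the sets S(·) and the pointers ptr(·).  "the unique colour not in {a,b}"
-- is expressed as "a colour different from a and from b".
data Step (p : ℕ → ℕ) (c : ℕ → Colour) (S : ℕ → List ℕ) (ptr : ℕ → ℕ) (i : ℕ) : Set where
  A1  : ptr i ≡ i →
        p (suc i) < suc i → c (p (suc i)) ≢ c i →
        c (suc i) ≢ c (p (suc i)) → c (suc i) ≢ c i →
        S (suc i) ≡ S i → ptr (suc i) ≡ suc i → Step p c S ptr i
  A2  : ptr i ≡ i →
        (suc i < p (suc i) ⊎ (p (suc i) < suc i × c (p (suc i)) ≡ c i)) →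
        c (suc i) ≢ c i →
        S (suc i) ≡ S i → ptr (suc i) ≡ i → Step p c S ptr i
  B1  : ptr i < i →
        p (suc i) ≤ ptr i → InC p c i (c (p (suc i))) →
        ¬ InC p c i (c (suc i)) →
        S (suc i) ≡ S i → ptr (suc i) ≡ ptr i → Step p c S ptr i
  B2a : ptr i < i →
        suc i < p (suc i) →
        ¬ InC p c i (c (suc i)) →
        S (suc i) ≡ suc i ∷ S i → ptr (suc i) ≡ suc i → Step p c S ptr i
  B2b : ptr i < i →
        p (suc i) ≤ ptr i → ¬ InC p c i (c (p (suc i))) →
        c (suc i) ≢ c i → c (suc i) ≢ c (p (suc i)) →
        S (suc i) ≡ i ∷ S i → ptr (suc i) ≡ suc i → Step p c S ptr i
  B2c : ptr i < i →
        suc (ptr i) ≤ p (suc i) → p (suc i) ≤ i → InC p c i (c (p (suc i))) →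
        ¬ InC p c i (c (suc i)) →
        S (suc i) ≡ suc i ∷ S i → ptr (suc i) ≡ suc i → Step p c S ptr i
  B2d : ptr i < i →
        suc (ptr i) ≤ p (suc i) → p (suc i) ≤ i → ¬ InC p c i (c (p (suc i))) →
        c (suc i) ≢ c i → c (suc i) ≢ c (p (suc i)) →
        S (suc i) ≡ i ∷ suc i ∷ S i → ptr (suc i) ≡ suc i → Step p c S ptr i

{-# OPTIONS --safe #-}
-- Along a run of type B with pointer k, every proper colouring d of G[[i]] that agrees
-- with c on [k] is determined by its colour at i (each new vertex of the run has only
-- its predecessor as neighbour inside the run), and d(i) never takes the colour of
-- C_{i+1} other than c(i) (it is the colour of an earlier neighbour of i).  Hence, as
-- c(i+1) ∉ C_{i+1}, a proper d with d(i+1) = c(i+1) must have d(i) = c(i).  This is what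
-- the vertices added to S at (B2a), (B2c), (B2d) exploit; at (A1) and (B2b) the new
-- vertex has two determined neighbours of different colours, so its colour is forced.
module Submission where

open import Defs
open import Data.Nat using (ℕ; zero; suc; _≤_; _<_; _∸_; _<?_; z≤n; s≤s)
open import Data.Nat.Properties
  using (≤-refl; ≤-trans; <⇒≤; <-irrefl; <-asym; ≤⇒≯; n≤1+n; m≤n⇒m≤1+n; m<n⇒m≤1+n;
         m≤n⇒m<n∨m≡n; m<1+n⇒m≤n; pred-cancel-<)
open import Data.Fin using (Fin; zero; punchOut)
open import Data.Fin.Properties using (punchOut-injective)
open import Data.List using (List; []; _∷_; [_]; _++_)
open import Data.List.Membership.Propositional using (_∈_)
open import Data.List.Membership.Propositional.Properties using (∈-++⁺ˡ; ∈-++⁺ʳ; ∈-++⁻)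
open import Data.List.Relation.Unary.All as All using (All; []; _∷_)
open import Data.List.Relation.Unary.Any using (here; there)
open import Data.Product as Product using (_×_; _,_; proj₁; proj₂)
open import Data.Sum as Sum using (_⊎_; inj₁; inj₂)
open import Function using (_∘_)
open import Level using (Level)
open import Relation.Nullary using (¬_; yes; no; contradiction)
open import Relation.Binary.PropositionalEquality
  using (_≡_; _≢_; refl; sym; trans; subst; subst₂; ≢-sym)

third-colour-unique : {a b x y : Colour} →
  a ≢ b → x ≢ a → x ≢ b → y ≢ a → y ≢ b → x ≡ y
-- Punching out a and then b sends x and y into Fin 1.
third-colour-unique {a} {b} {x} {y} a≢b x≢a x≢b y≢a y≢b =
  punchOut-injective a≢x a≢y (punchOut-injective b′≢x′ b′≢y′ (Fin1-unique _ _))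
  where
  a≢x : a ≢ x
  a≢x = ≢-sym x≢a
  a≢y : a ≢ y
  a≢y = ≢-sym y≢a
  b′≢x′ : punchOut a≢b ≢ punchOut a≢x
  b′≢x′ = ≢-sym x≢b ∘ punchOut-injective a≢b a≢x
  b′≢y′ : punchOut a≢b ≢ punchOut a≢y
  b′≢y′ = ≢-sym y≢b ∘ punchOut-injective a≢b a≢y
  Fin1-unique : (u v : Fin 1) → u ≡ v
  Fin1-unique zero zero = refl

m≤1+n⇒m≤n∨m≡1+n : ∀ {m n} → m ≤ suc n → m ≤ n ⊎ m ≡ suc n
m≤1+n⇒m≤n∨m≡1+n = Sum.map₁ m<1+n⇒m≤n ∘ m≤n⇒m<n∨m≡n

induction-between : ∀ {ℓ : Level} (P : ℕ → Set ℓ) {i₀ i₁ : ℕ} → P i₀ →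
  (∀ i → i₀ ≤ i → i < i₁ → P i → P (suc i)) →
  ∀ i → i₀ ≤ i → i ≤ i₁ → P i
induction-between P base step zero z≤n _ = base
induction-between P base step (suc i) i₀≤1+i i<i₁ with m≤1+n⇒m≤n∨m≡1+n i₀≤1+i
... | inj₁ i₀≤i = step i i₀≤i i<i₁ (induction-between P base step i i₀≤i (<⇒≤ i<i₁))
... | inj₂ refl = base

Agree : ℕ → (ℕ → Colour) → (ℕ → Colour) → Set
Agree k d c = ∀ j → 1 ≤ j → j ≤ k → d j ≡ c j

agree-suc : ∀ {k d c} → Agree k d c → d (suc k) ≡ c (suc k) → Agree (suc k) d c
agree-suc agree d≡c j 1≤j j≤1+k with m≤1+n⇒m≤n∨m≡1+n j≤1+k
... | inj₁ j≤k = agree j 1≤j j≤k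
... | inj₂ refl = d≡c

module _ {n : ℕ} {p : ℕ → ℕ} where

  proper-mono : ∀ {m k d} → m ≤ k → Proper n p k d → Proper n p m d
  proper-mono m≤k proper i j 1≤i i≤m 1≤j j≤m =
    proper i j 1≤i (≤-trans i≤m m≤k) 1≤j (≤-trans j≤m m≤k)

  proper-transfer : ∀ {k c c′} → Agree k c c′ → Proper n p k c′ → Proper n p k c
  proper-transfer c≡c′ proper i j 1≤i i≤k 1≤j j≤k i~j cᵢ≡cⱼ =
    proper i j 1≤i i≤k 1≤j j≤k i~j
      (trans (sym (c≡c′ i 1≤i i≤k)) (trans cᵢ≡cⱼ (c≡c′ j 1≤j j≤k)))

  sudoku-transfer : ∀ {k S c c′} → Agree k c c′ → Sudoku n p k S c′ → Sudoku n p k S c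
  sudoku-transfer {k} {S} {c} {c′} c≡c′ (S⊆[k] , proper , unique) =
    S⊆[k] , proper-transfer c≡c′ proper , unique′
    where
    unique′ : ∀ d → Proper n p k d → (∀ j → j ∈ S → d j ≡ c j) → Agree k d c
    unique′ d proper-d d≡c j 1≤j j≤k =
      trans (unique d proper-d d≡c′ j 1≤j j≤k) (sym (c≡c′ j 1≤j j≤k))
      where
      d≡c′ : ∀ j → j ∈ S → d j ≡ c′ j
      d≡c′ j j∈S = trans (d≡c j j∈S) (c≡c′ j (proj₁ (S⊆[k] j j∈S)) (proj₂ (S⊆[k] j j∈S)))

  sudoku-agree : ∀ {k m S c d} → Sudoku n p k S c → k ≤ m → Proper n p m d →
    (∀ j → j ∈ S → d j ≡ c j) → Agree k d c
  sudoku-agree (_ , _ , unique) k≤m proper = unique _ (proper-mono k≤m proper)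

  sudoku-extend : ∀ {k m S c} T → Sudoku n p k S c → k ≤ m →
    All (λ j → 1 ≤ j × j ≤ m) T → Proper n p m c →
    (∀ d → Proper n p m d → Agree k d c → (∀ j → j ∈ T → d j ≡ c j) → Agree m d c) →
    Sudoku n p m (T ++ S) c
  sudoku-extend {k} {m} {S} {c} T sudoku k≤m T⊆[m] proper determined =
    T++S⊆[m] , proper , unique
    where
    T++S⊆[m] : ∀ j → j ∈ T ++ S → 1 ≤ j × j ≤ m
    T++S⊆[m] j j∈T++S with ∈-++⁻ T j∈T++S
    ... | inj₁ j∈T = All.lookup T⊆[m] j∈T
    ... | inj₂ j∈S = Product.map₂ (λ j≤k → ≤-trans j≤k k≤m) (proj₁ sudoku j j∈S)
    unique : ∀ d → Proper n p m d → (∀ j → j ∈ T ++ S → d j ≡ c j) → Agree m d c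
    unique d proper-d d≡c =
      determined d proper-d
        (sudoku-agree sudoku k≤m proper-d (λ j → d≡c j ∘ ∈-++⁺ʳ T))
        (λ j → d≡c j ∘ ∈-++⁺ˡ)

module _ {n : ℕ} {p : ℕ → ℕ} (pm : PerfectMatching n p) where

  partner-≢ : ∀ {i} → 1 ≤ i → i ≤ n → p i ≢ i
  partner-≢ 1≤i i≤n = proj₁ (proj₂ (proj₂ (pm _ 1≤i i≤n)))

  adj-sym : ∀ {i j} → 1 ≤ i → i ≤ n → Adj n p i j → Adj n p j i
  adj-sym _ _ (inj₁ j≡1+i) = inj₂ (inj₁ j≡1+i)
  adj-sym _ _ (inj₂ (inj₁ i≡1+j)) = inj₁ i≡1+j
  adj-sym _ _ (inj₂ (inj₂ (inj₁ (i≡n , j≡1)))) = inj₂ (inj₂ (inj₂ (inj₁ (j≡1 , i≡n))))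
  adj-sym _ _ (inj₂ (inj₂ (inj₂ (inj₁ (i≡1 , j≡n))))) = inj₂ (inj₂ (inj₁ (j≡n , i≡1)))
  adj-sym 1≤i i≤n (inj₂ (inj₂ (inj₂ (inj₂ refl)))) =
    inj₂ (inj₂ (inj₂ (inj₂ (proj₂ (proj₂ (proj₂ (pm _ 1≤i i≤n)))))))

  earlier-neighbour : ∀ {k j} → suc k < n → j ≤ suc k → Adj n p (suc k) j →
    j ≡ k ⊎ (j ≡ p (suc k) × j ≤ k)
  earlier-neighbour _ j≤1+k (inj₁ refl) = contradiction j≤1+k (<-irrefl refl)
  earlier-neighbour _ _ (inj₂ (inj₁ refl)) = inj₁ refl
  earlier-neighbour 1+k<n _ (inj₂ (inj₂ (inj₁ (1+k≡n , _)))) =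
    contradiction 1+k<n (<-irrefl 1+k≡n)
  earlier-neighbour 1+k<n n≤1+k (inj₂ (inj₂ (inj₂ (inj₁ (_ , refl))))) =
    contradiction 1+k<n (≤⇒≯ n≤1+k)
  earlier-neighbour 1+k<n j≤1+k (inj₂ (inj₂ (inj₂ (inj₂ refl)))) with m≤1+n⇒m≤n∨m≡1+n j≤1+k
  ... | inj₁ j≤k = inj₂ (refl , j≤k)
  ... | inj₂ p≡1+k = contradiction p≡1+k (partner-≢ (s≤s z≤n) (<⇒≤ 1+k<n))

  new-vertex-≢ : ∀ {k} {d : ℕ → Colour} → suc k < n → d (suc k) ≢ d k →
    (p (suc k) ≤ k → d (suc k) ≢ d (p (suc k))) →
    ∀ j → j ≤ suc k → Adj n p (suc k) j → d (suc k) ≢ d j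
  new-vertex-≢ 1+k<n ≢pred ≢partner j j≤1+k 1+k~j with earlier-neighbour 1+k<n j≤1+k 1+k~j
  ... | inj₁ refl = ≢pred
  ... | inj₂ (refl , j≤k) = ≢partner j≤k

  proper-suc : ∀ {k d} → suc k < n → Proper n p k d → d (suc k) ≢ d k →
    (p (suc k) ≤ k → d (suc k) ≢ d (p (suc k))) → Proper n p (suc k) d
  proper-suc 1+k<n proper ≢pred ≢partner i j 1≤i i≤1+k 1≤j j≤1+k i~j
    with m≤1+n⇒m≤n∨m≡1+n i≤1+k | m≤1+n⇒m≤n∨m≡1+n j≤1+k
  ... | inj₁ i≤k | inj₁ j≤k = proper i j 1≤i i≤k 1≤j j≤k i~j
  ... | inj₂ refl | _ = new-vertex-≢ 1+k<n ≢pred ≢partner j j≤1+k i~j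
  ... | inj₁ _ | inj₂ refl = λ dᵢ≡dⱼ →
    new-vertex-≢ 1+k<n ≢pred ≢partner i i≤1+k (adj-sym 1≤i (≤-trans i≤1+k (<⇒≤ 1+k<n)) i~j)
      (sym dᵢ≡dⱼ)

otherInC : (ℕ → ℕ) → (ℕ → Colour) → ℕ → Colour
otherInC p c i with i <? p i
... | yes _ = c (i ∸ 1)
... | no _  = c (p i)

module OtherInC (p : ℕ → ℕ) (c : ℕ → Colour) {i : ℕ} where

  InC-current : InC p c i (c i)
  InC-current with i <? p i
  ... | yes _ = inj₂ refl
  ... | no _  = inj₁ refl

  InC-other : InC p c i (otherInC p c i)
  InC-other with i <? p i
  ... | yes _ = inj₁ refl
  ... | no _  = inj₂ refl

  otherInC-above : i < p i → otherInC p c i ≡ c (i ∸ 1)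
  otherInC-above i<pᵢ with i <? p i
  ... | yes _    = refl
  ... | no i≮pᵢ = contradiction i<pᵢ i≮pᵢ

  otherInC-below : p i < i → otherInC p c i ≡ c (p i)
  otherInC-below pᵢ<i with i <? p i
  ... | yes i<pᵢ = contradiction pᵢ<i (<-asym i<pᵢ)
  ... | no _     = refl

  ∉InC⇒≢ : ∀ {x y} → ¬ InC p c i x → InC p c i y → x ≢ y
  ∉InC⇒≢ x∉C y∈C refl = x∉C y∈C

module Procedure {n : ℕ} {p : ℕ → ℕ} (pm : PerfectMatching n p) (c : ℕ → Colour) where

  open OtherInC p c

  record Run (k i : ℕ) : Set where
    field
      determined    : ∀ d → Proper n p i d → Agree k d c → d i ≡ c i → Agree i d c
      other≢current : otherInC p c i ≢ c i
      avoids-other  : ∀ d → Proper n p i d → Agree k d c → d i ≢ otherInC p c i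

  record Invariant (k : ℕ) (T : List ℕ) (i : ℕ) : Set where
    field
      sudoku : Sudoku n p k T c
      proper : Proper n p i c
      run    : k < i → Run k i

  reset : ∀ {i T} → Sudoku n p i T c → Invariant i T i
  reset sudoku = record
    { sudoku = sudoku
    ; proper = proj₁ (proj₂ sudoku)
    ; run    = λ i<i → contradiction i<i (<-irrefl refl)
    }

  module AtStep {i : ℕ} (1≤i : 1 ≤ i) (1+i<n : suc i < n) where

    1≤p : 1 ≤ p (suc i)
    1≤p = proj₁ (pm (suc i) (s≤s z≤n) (<⇒≤ 1+i<n))

    ≢-pred : ∀ {d} → Proper n p (suc i) d → d (suc i) ≢ d i
    ≢-pred proper = proper (suc i) i (s≤s z≤n) ≤-refl 1≤i (n≤1+n i) (inj₂ (inj₁ refl))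

    ≢-partner : ∀ {d} → Proper n p (suc i) d → p (suc i) ≤ i → d (suc i) ≢ d (p (suc i))
    ≢-partner proper p≤i =
      proper (suc i) (p (suc i)) (s≤s z≤n) ≤-refl 1≤p (m≤n⇒m≤1+n p≤i)
        (inj₂ (inj₂ (inj₂ (inj₂ refl))))

    agree-forced : ∀ {d} → Proper n p (suc i) d → Agree i d c → p (suc i) ≤ i →
      c (p (suc i)) ≢ c i → c (suc i) ≢ c (p (suc i)) → c (suc i) ≢ c i → Agree (suc i) d c
    agree-forced {d} proper-d agree p≤i cₚ≢cᵢ c≢cₚ c≢cᵢ =
      agree-suc agree (third-colour-unique cₚ≢cᵢ d≢cₚ d≢cᵢ c≢cₚ c≢cᵢ)
      where
      d≢cₚ : d (suc i) ≢ c (p (suc i))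
      d≢cₚ = subst (d (suc i) ≢_) (agree _ 1≤p p≤i) (≢-partner proper-d p≤i)
      d≢cᵢ : d (suc i) ≢ c i
      d≢cᵢ = subst (d (suc i) ≢_) (agree i 1≤i ≤-refl) (≢-pred proper-d)

    run-agree : ∀ {k d} → Run k i → Proper n p (suc i) d → Agree k d c → d i ≡ c i → Agree i d c
    run-agree run proper-d = Run.determined run _ (proper-mono (n≤1+n i) proper-d)

    run-agree-suc : ∀ {k d} → Run k i → ¬ InC p c i (c (suc i)) → Proper n p (suc i) d →
      Agree k d c → d (suc i) ≡ c (suc i) → Agree (suc i) d c
    run-agree-suc {d = d} run c∉C proper-d agree d≡c =
      agree-suc (run-agree run proper-d agree dᵢ≡cᵢ) d≡c
      where
      open Run run
      dᵢ≡cᵢ : d i ≡ c i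
      dᵢ≡cᵢ = third-colour-unique
        (∉InC⇒≢ c∉C InC-other)
        (λ dᵢ≡c → ≢-pred proper-d (trans d≡c (sym dᵢ≡c)))
        (avoids-other d (proper-mono (n≤1+n i) proper-d) agree)
        (≢-sym (∉InC⇒≢ c∉C InC-current))
        (≢-sym other≢current)

    run-start : c (suc i) ≢ c i → otherInC p c (suc i) ≡ c i → Run i (suc i)
    run-start c≢cᵢ other≡cᵢ = record
      { determined    = λ _ _ agree → agree-suc agree
      ; other≢current = λ other≡c → c≢cᵢ (trans (sym other≡c) other≡cᵢ)
      ; avoids-other  = λ d proper-d agree d≡other →
          ≢-pred proper-d (trans d≡other (trans other≡cᵢ (sym (agree i 1≤i ≤-refl))))
      }

    run-suc : ∀ {k} → Run k i → k < i → p (suc i) ≤ k →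
      InC p c i (c (p (suc i))) → ¬ InC p c i (c (suc i)) → Run k (suc i)
    run-suc run k<i p≤k cₚ∈C c∉C = record
      { determined    = λ _ proper-d agree → run-agree-suc run c∉C proper-d agree
      ; other≢current = subst (_≢ c (suc i)) (sym other≡cₚ) (≢-sym (∉InC⇒≢ c∉C cₚ∈C))
      ; avoids-other  = λ d proper-d agree →
          subst (d (suc i) ≢_) (trans (agree _ 1≤p p≤k) (sym other≡cₚ)) (≢-partner proper-d p≤i)
      }
      where
      p≤i : p (suc i) ≤ i
      p≤i = ≤-trans p≤k (<⇒≤ k<i)
      other≡cₚ : otherInC p c (suc i) ≡ c (p (suc i))
      other≡cₚ = otherInC-below (s≤s p≤i)

    proper-next : Proper n p i c → c (suc i) ≢ c i →
      (p (suc i) ≤ i → c (suc i) ≢ c (p (suc i))) → Proper n p (suc i) c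
    proper-next = proper-suc pm 1+i<n

    proper-next-∉C : Proper n p i c → ¬ InC p c i (c (suc i)) → InC p c i (c (p (suc i))) →
      Proper n p (suc i) c
    proper-next-∉C proper c∉C cₚ∈C =
      proper-next proper (∉InC⇒≢ c∉C InC-current) (λ _ → ∉InC⇒≢ c∉C cₚ∈C)

    sudoku-add-forced : ∀ {T} → Sudoku n p i T c → p (suc i) ≤ i →
      c (p (suc i)) ≢ c i → c (suc i) ≢ c (p (suc i)) → c (suc i) ≢ c i → Sudoku n p (suc i) T c
    sudoku-add-forced sudoku p≤i cₚ≢cᵢ c≢cₚ c≢cᵢ =
      sudoku-extend [] sudoku (n≤1+n i) [] (proper-next (proj₁ (proj₂ sudoku)) c≢cᵢ (λ _ → c≢cₚ))
        (λ _ proper-d agree _ → agree-forced proper-d agree p≤i cₚ≢cᵢ c≢cₚ c≢cᵢ)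

    sudoku-add-suc : ∀ {k T} → k < i → Sudoku n p k T c → Run k i →
      ¬ InC p c i (c (suc i)) → Proper n p (suc i) c → Sudoku n p (suc i) (suc i ∷ T) c
    sudoku-add-suc k<i sudoku run c∉C proper =
      sudoku-extend [ suc i ] sudoku (m<n⇒m≤1+n k<i) ((s≤s z≤n , ≤-refl) ∷ []) proper
        (λ _ proper-d agree d≡c → run-agree-suc run c∉C proper-d agree (d≡c _ (here refl)))

    sudoku-add-pred-forced : ∀ {k T} → k < i → Sudoku n p k T c → Run k i → p (suc i) ≤ k →
      ¬ InC p c i (c (p (suc i))) → c (suc i) ≢ c i → c (suc i) ≢ c (p (suc i)) →
      Proper n p (suc i) c → Sudoku n p (suc i) (i ∷ T) c
    sudoku-add-pred-forced k<i sudoku run p≤k cₚ∉C c≢cᵢ c≢cₚ proper =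
      sudoku-extend [ i ] sudoku (m<n⇒m≤1+n k<i) ((1≤i , n≤1+n i) ∷ []) proper
        (λ _ proper-d agree d≡c →
          agree-forced proper-d (run-agree run proper-d agree (d≡c i (here refl)))
            (≤-trans p≤k (<⇒≤ k<i)) (∉InC⇒≢ cₚ∉C InC-current) c≢cₚ c≢cᵢ)

    sudoku-add-pred-suc : ∀ {k T} → k < i → Sudoku n p k T c → Run k i →
      Proper n p (suc i) c → Sudoku n p (suc i) (i ∷ suc i ∷ T) c
    sudoku-add-pred-suc k<i sudoku run proper =
      sudoku-extend (i ∷ suc i ∷ []) sudoku (m<n⇒m≤1+n k<i)
        ((1≤i , n≤1+n i) ∷ (s≤s z≤n , ≤-refl) ∷ []) proper
        (λ _ proper-d agree d≡c →
          agree-suc (run-agree run proper-d agree (d≡c i (here refl)))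
            (d≡c _ (there (here refl))))

    invariant-start-run : ∀ {T} → Sudoku n p i T c → c (suc i) ≢ c i →
      suc i < p (suc i) ⊎ (p (suc i) < suc i × c (p (suc i)) ≡ c i) → Invariant i T (suc i)
    invariant-start-run sudoku c≢cᵢ cond = record
      { sudoku = sudoku
      ; proper = proper-next (proj₁ (proj₂ sudoku)) c≢cᵢ c≢cₚ
      ; run    = λ _ → run-start c≢cᵢ other≡cᵢ
      }
      where
      c≢cₚ : p (suc i) ≤ i → c (suc i) ≢ c (p (suc i))
      c≢cₚ p≤i = Sum.[ (λ 1+i<p → contradiction (<⇒≤ 1+i<p) (≤⇒≯ p≤i))
                     , (λ (_ , cₚ≡cᵢ) → subst (c (suc i) ≢_) (sym cₚ≡cᵢ) c≢cᵢ) ] cond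
      other≡cᵢ : otherInC p c (suc i) ≡ c i
      other≡cᵢ = Sum.[ otherInC-above
                     , (λ (p<1+i , cₚ≡cᵢ) → trans (otherInC-below p<1+i) cₚ≡cᵢ) ] cond

    invariant-step : ∀ {S ptr} → Invariant (ptr i) (S i) i → Step p c S ptr i →
      Invariant (ptr (suc i)) (S (suc i)) (suc i)
    invariant-step {S} inv (A1 ptr≡i p<1+i cₚ≢cᵢ c≢cₚ c≢cᵢ eS eP) rewrite eS | eP =
      reset (sudoku-add-forced (subst (λ k → Sudoku n p k (S i) c) ptr≡i (Invariant.sudoku inv))
              (m<1+n⇒m≤n p<1+i) cₚ≢cᵢ c≢cₚ c≢cᵢ)
    invariant-step {S} inv (A2 ptr≡i cond c≢cᵢ eS eP) rewrite eS | eP =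
      invariant-start-run (subst (λ k → Sudoku n p k (S i) c) ptr≡i (Invariant.sudoku inv)) c≢cᵢ cond
    invariant-step inv (B1 ptr<i p≤ptr cₚ∈C c∉C eS eP) rewrite eS | eP = record
      { sudoku = sudoku
      ; proper = proper-next-∉C proper c∉C cₚ∈C
      ; run    = λ _ → run-suc (run ptr<i) ptr<i p≤ptr cₚ∈C c∉C
      }
      where open Invariant inv
    invariant-step inv (B2a ptr<i 1+i<p c∉C eS eP) rewrite eS | eP =
      reset (sudoku-add-suc ptr<i sudoku (run ptr<i) c∉C
              (proper-next proper (∉InC⇒≢ c∉C InC-current)
                (λ p≤i → contradiction (<⇒≤ 1+i<p) (≤⇒≯ p≤i))))
      where open Invariant inv
    invariant-step inv (B2b ptr<i p≤ptr cₚ∉C c≢cᵢ c≢cₚ eS eP) rewrite eS | eP =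
      reset (sudoku-add-pred-forced ptr<i sudoku (run ptr<i) p≤ptr cₚ∉C c≢cᵢ c≢cₚ
              (proper-next proper c≢cᵢ (λ _ → c≢cₚ)))
      where open Invariant inv
    invariant-step inv (B2c ptr<i _ _ cₚ∈C c∉C eS eP) rewrite eS | eP =
      reset (sudoku-add-suc ptr<i sudoku (run ptr<i) c∉C (proper-next-∉C proper c∉C cₚ∈C))
      where open Invariant inv
    invariant-step inv (B2d ptr<i _ _ _ c≢cᵢ c≢cₚ eS eP) rewrite eS | eP =
      reset (sudoku-add-pred-suc ptr<i sudoku (run ptr<i) (proper-next proper c≢cᵢ (λ _ → c≢cₚ)))
      where open Invariant inv

lemma2p1 : (n : ℕ) (p : ℕ → ℕ) → PerfectMatching n p →
    (i₀ i₁ : ℕ) → 1 ≤ i₀ → i₀ ≤ i₁ → i₁ ≤ n ∸ 1 →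
    (c₀ : ℕ → Colour) (S₀ : List ℕ) → Sudoku n p i₀ S₀ c₀ →
    (c : ℕ → Colour) (S : ℕ → List ℕ) (ptr : ℕ → ℕ) →
    (∀ j → 1 ≤ j → j ≤ i₀ → c j ≡ c₀ j) → S i₀ ≡ S₀ → ptr i₀ ≡ i₀ →
    (∀ i → i₀ ≤ i → i < i₁ → Step p c S ptr i) →
    Sudoku n p (ptr i₁) (S i₁) c
lemma2p1 n p pm i₀ i₁ 1≤i₀ i₀≤i₁ i₁≤n∸1 c₀ S₀ sudoku₀ c S ptr c≡c₀ S≡S₀ ptr≡i₀ steps =
  Invariant.sudoku (induction-between Inv initial step i₁ i₀≤i₁ ≤-refl)
  where
  open Procedure pm c
  Inv : ℕ → Set
  Inv i = Invariant (ptr i) (S i) i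
  initial : Inv i₀
  initial = subst₂ (λ k T → Invariant k T i₀) (sym ptr≡i₀) (sym S≡S₀)
              (reset (sudoku-transfer c≡c₀ sudoku₀))
  step : ∀ i → i₀ ≤ i → i < i₁ → Inv i → Inv (suc i)
  step i i₀≤i i<i₁ inv =
    AtStep.invariant-step (≤-trans 1≤i₀ i₀≤i) (pred-cancel-< {m = suc i} (≤-trans i<i₁ i₁≤n∸1))
      inv (steps i i₀≤i i<i₁)
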